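{- Let $k\geq 5$, $r\geq 1$ and $0\leq\alpha\leq rk-2$ be integers, and let $m\in[1,k]$ be the integer with $(m-1)r\leq\alpha<mr$. If $\mathcal{A}$ is a finite sequence of positive integers with $k$ distinct terms each repeated exactly $r$ times such that \[|\Sigma_{\alpha}(r,\mathcal{A})|=r\left[\frac{k(k+1)}{2}-\frac{m(m+1)}{2}\right]+m(mr-\alpha)+1,\] then $\mathcal{A}=d*[1,k]_r$ for some positive integer $d$. If $\mathcal{A}$ is a finite sequence of nonnegative integers with $k$ distinct terms each repeated exactly $r$ times and $0\in\mathcal{A}$, such that \[|\Sigma_{\alpha}(r,\mathcal{A})|=r\left[\frac{(k-1)k}{2}-\frac{(m-1)m}{2}\right]+(m-1)(mr-\alpha)+1,\] then $\mathcal{A}=d*[0,k-1]_r$ for some positive integer $d$.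
   Context: For distinct integers $a_1,\ldots,a_k$ and $r\geq1$, $(a_1,\ldots,a_k)_r$ denotes the finite sequence consisting of $r$ copies of each $a_i$. For such a sequence $\mathcal{A}$ and an integer $0\leq\alpha\leq rk$, $\Sigma_{\alpha}(r,\mathcal{A})$ is the set of sums $s(\mathcal{B})$ of all terms of $\mathcal{B}$, over all subsequences $\mathcal{B}$ of $\mathcal{A}$ of length at least $\alpha$ (the empty subsequence has sum $0$). For integers $a\leq b$, $[a,b]_r=(a,a+1,\ldots,b)_r$, and for a positive integer $d$, $d*(a_1,\ldots,a_k)_r=(da_1,\ldots,da_k)_r$. -}

module Defs where

open import Data.Nat using (ℕ; zero; suc; _+_; _*_; _≤_; _≟_)
open import Data.Nat.Properties using (_≤?_)
open import Data.List using (List; []; _∷_; _++_; map; concatMap; replicate; length; filter; deduplicate; upTo)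
open import Data.Fin using (Fin)
import Data.List as L
open import Data.Nat.ListAction using (sum)

rep : ℕ → List ℕ → List ℕ
rep r = concatMap (replicate r)

seqOf : {k : ℕ} → ℕ → (Fin k → ℕ) → List ℕ
seqOf {k} r a = rep r (L.tabulate a)

_*seq_ : ℕ → List ℕ → List ℕ
d *seq xs = map (d *_) xs

oneTo : ℕ → ℕ → List ℕ
oneTo k r = rep r (map suc (upTo k))

zeroTo : ℕ → ℕ → List ℕ
zeroTo k r = rep r (upTo k)

subseqs : List ℕ → List (List ℕ)
subseqs [] = [] ∷ []
subseqs (x ∷ xs) = map (x ∷_) (subseqs xs) ++ subseqs xs

Σ-list : ℕ → List ℕ → List ℕ
Σ-list α xs = deduplicate _≟_ (map sum (filter (λ b → α ≤? length b) (subseqs xs)))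

card-Σ : ℕ → List ℕ → ℕ
card-Σ α xs = length (Σ-list α xs)

module Submission where

-- Sort the k distinct terms as b₁ < … < b_k. A subsequence of (b)_r is described by a
-- configuration c = (c₁,…,c_k), 0 ≤ cᵢ ≤ r, of size Σ cᵢ and sum Σ cᵢbᵢ; it is admissible
-- when its size is at least α. The height Σ i·cᵢ rises by exactly one under each raise
-- (add a copy of b₁, or replace a copy of bᵢ by b_{i+1}), and for positive increasing
-- terms each raise strictly increases the sum. Every admissible configuration lies on a
-- chain of raises from a staircase of minimal height hmin to the full configuration of
-- height hmax, so Σ_α contains height c − hmin + 1 sums ≤ that of c and hmax − height c + 1
-- sums ≥ it; counting shows that if |Σ_α| = hmax − hmin + 1 then any two raises of an
-- admissible configuration give the same sum. Applied to configurations missing two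
-- copies (admissible since α ≤ rk − 2), this forces b_{i+1} − bᵢ = b₁, so 𝒜 = b₁ * [1,k]_r.
-- With a zero term, all copies of 0 are always selectable: the positive terms are extremal
-- for α − r, giving 𝒜 = b₂ * [0,k−1]_r.

open import Defs
open import Data.Nat using (ℕ; zero; suc; _+_; _*_; _∸_; _/_; _≤_; _<_; z≤n; s≤s; s≤s⁻¹; _≟_)
open import Data.Nat.Properties
open import Data.Nat.DivMod using (m*n/n≡m)
open import Data.Nat.ListAction using (sum)
open import Data.Nat.ListAction.Properties using (sum-++)
open import Data.Nat.Tactic.RingSolver using (solve-∀)
open import Data.Fin using (Fin)
open import Data.List using (List; []; _∷_; _++_; length; replicate; filter; map; tabulate; concatMap; applyUpTo; upTo)
open import Data.List.Properties
  using (filter-notAll; length-++; length-replicate; length-tabulate; map-concatMap; concatMap-cong;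
         concatMap-map; map-replicate; map-applyUpTo; map-upTo)
open import Data.List.Sort ≤-decTotalOrder using (sort; sort-↭; sort-↗)
open import Data.List.Relation.Unary.Unique.Propositional using (Unique)
import Data.List.Relation.Unary.Unique.Propositional.Properties as Uniqueₚ
open import Data.List.Membership.Propositional using (_∈_)
open import Data.List.Membership.Propositional.Properties
  using (∈-map⁺; ∈-map⁻; ∈-++⁺ˡ; ∈-++⁺ʳ; ∈-++⁻; ∈-filter⁺; ∈-deduplicate⁺; ∈-tabulate⁺)
open import Data.List.Relation.Unary.Any as Any using (here; there)
open import Data.List.Relation.Unary.All as All using (All; []; _∷_)
import Data.List.Relation.Unary.All.Properties as Allₚ
open import Data.List.Relation.Unary.AllPairs using ([]; _∷_)
open import Data.List.Relation.Unary.Linked using (Linked; []; [-]; _∷_)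
open import Data.List.Relation.Unary.Linked.Properties using (Linked⇒All)
open import Data.List.Relation.Binary.Permutation.Propositional
  using (_↭_; prep; swap; ↭-sym; ↭-reflexive; ↭⇒↭ₛ) renaming (refl to ↭-refl; trans to ↭-trans)
open import Data.List.Relation.Binary.Permutation.Propositional.Properties using (++⁺ˡ; shifts; ↭-length; All-resp-↭; Any-resp-↭)
open import Function using (_∘_)
open import Data.Product using (∃; ∃₂; _×_; _,_)
open import Data.Sum using (_⊎_; inj₁; inj₂)
open import Relation.Nullary using (¬_; yes; no; contradiction)
open import Relation.Unary using (Decidable)
open import Relation.Binary.PropositionalEquality
open import Relation.Binary.PropositionalEquality.Properties using (setoid)
open import Data.List.Relation.Binary.Permutation.Setoid.Properties (setoid ℕ) using (Unique-resp-↭)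

count : {P : ℕ → Set} → Decidable P → List ℕ → ℕ
count P? U = length (filter P? U)

count-mono : {P Q : ℕ → Set} (P? : Decidable P) (Q? : Decidable Q) → (∀ {x} → P x → Q x)
  → ∀ U → count P? U ≤ count Q? U
count-mono P? Q? P⊆Q [] = z≤n
count-mono P? Q? P⊆Q (x ∷ U) with P? x | Q? x
... | yes _  | yes _  = s≤s (count-mono P? Q? P⊆Q U)
... | yes px | no ¬qx = contradiction (P⊆Q px) ¬qx
... | no _   | yes _  = m≤n⇒m≤1+n (count-mono P? Q? P⊆Q U)
... | no _   | no _   = count-mono P? Q? P⊆Q U

count-strict : {P Q : ℕ → Set} (P? : Decidable P) (Q? : Decidable Q) → (∀ {x} → P x → Q x)
  → ∀ U {u} → u ∈ U → Q u → ¬ P u → count P? U < count Q? U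
count-strict P? Q? P⊆Q (x ∷ U) (here refl) qu ¬pu with P? x | Q? x
... | yes pu | _      = contradiction pu ¬pu
... | no _   | yes _  = s≤s (count-mono P? Q? P⊆Q U)
... | no _   | no ¬qu = contradiction qu ¬qu
count-strict P? Q? P⊆Q (x ∷ U) (there u∈U) qu ¬pu with P? x | Q? x
... | yes _  | yes _  = s≤s (count-strict P? Q? P⊆Q U u∈U qu ¬pu)
... | yes px | no ¬qx = contradiction (P⊆Q px) ¬qx
... | no _   | yes _  = m≤n⇒m≤1+n (count-strict P? Q? P⊆Q U u∈U qu ¬pu)
... | no _   | no _   = count-strict P? Q? P⊆Q U u∈U qu ¬pu

-- A configuration for distinct terms b = (b₁,…,b_k), each available r times, is a list
-- c = (c₁,…,c_k) of multiplicities 0 ≤ cᵢ ≤ r; it selects a subsequence of (b)_r of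
-- length sum c and with sum of terms dot b c.
data Config (r : ℕ) : List ℕ → List ℕ → Set where
  []  : Config r [] []
  _∷_ : ∀ {x y b c} → x ≤ r → Config r b c → Config r (y ∷ b) (x ∷ c)

dot : List ℕ → List ℕ → ℕ
dot (y ∷ b) (x ∷ c) = x * y + dot b c
dot _       _       = 0

-- The height Σᵢ i·cᵢ of a configuration, computed as Σᵢ (cᵢ + … + c_k).
height : List ℕ → ℕ
height []      = 0
height (x ∷ c) = sum (x ∷ c) + height c

config-length : ∀ {r b c} → Config r b c → length c ≡ length b
config-length []       = refl
config-length (_ ∷ cf) = cong suc (config-length cf)

Increasing : List ℕ → Set
Increasing = Linked _<_

data Shift (r : ℕ) : List ℕ → List ℕ → List ℕ → ℕ → ℕ → Set where
  here  : ∀ {x z y y' b c} → z < r →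
          Shift r (y ∷ y' ∷ b) (suc x ∷ z ∷ c) (x ∷ suc z ∷ c) y y'
  there : ∀ {x y b c c' lo hi} → Shift r b c c' lo hi →
          Shift r (y ∷ b) (x ∷ c) (x ∷ c') lo hi

data Raise (r : ℕ) : List ℕ → List ℕ → List ℕ → Set where
  add   : ∀ {x y b c} → x < r → Raise r (y ∷ b) (x ∷ c) (suc x ∷ c)
  shift : ∀ {b c c' lo hi} → Shift r b c c' lo hi → Raise r b c c'

module _ {r : ℕ} where

  shift-dot : ∀ {b c c' lo hi} → Shift r b c c' lo hi → dot b c' + lo ≡ dot b c + hi
  shift-dot {y ∷ y' ∷ b} {suc x ∷ z ∷ c} (here _) = expand x y z y' (dot b c)
    where
    expand : ∀ x y z y' D → x * y + (suc z * y' + D) + y ≡ suc x * y + (z * y' + D) + y'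
    expand = solve-∀
  shift-dot {y ∷ b} {x ∷ c} {x ∷ c'} {lo} {hi} (there sh) = begin
    x * y + dot b c' + lo   ≡⟨ +-assoc (x * y) (dot b c') lo ⟩
    x * y + (dot b c' + lo) ≡⟨ cong (x * y +_) (shift-dot sh) ⟩
    x * y + (dot b c + hi)  ≡⟨ +-assoc (x * y) (dot b c) hi ⟨
    x * y + dot b c + hi    ∎
    where open ≡-Reasoning

  shift-lt : ∀ {b c c' lo hi} → Increasing b → Shift r b c c' lo hi → lo < hi
  shift-lt (lo<hi ∷ _) (here _)   = lo<hi
  shift-lt (_ ∷ inc)   (there sh) = shift-lt inc sh
  shift-lt [-]         (there ())

  shift-size : ∀ {b c c' lo hi} → Shift r b c c' lo hi → sum c' ≡ sum c
  shift-size {c = suc x ∷ z ∷ c} (here _)   = +-suc x (z + sum c)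
  shift-size {c = x ∷ c}         (there sh) = cong (x +_) (shift-size sh)

  shift-height : ∀ {b c c' lo hi} → Shift r b c c' lo hi → height c' ≡ suc (height c)
  shift-height {c = suc x ∷ z ∷ c} (here _) = expand x z (sum c) (height c)
    where
    expand : ∀ x z S h → x + (suc z + S) + (suc z + S + h) ≡ suc (suc x + (z + S) + (z + S + h))
    expand = solve-∀
  shift-height {c = x ∷ c} (there sh) =
    trans (cong₂ _+_ (cong (x +_) (shift-size sh)) (shift-height sh)) (+-suc (x + sum c) (height c))

  shift-config : ∀ {b c c' lo hi} → Config r b c → Shift r b c c' lo hi → Config r b c'
  shift-config (x≤r ∷ z≤r ∷ cf) (here z<r) = ≤-trans (n≤1+n _) x≤r ∷ (z<r ∷ cf)
  shift-config (x≤r ∷ cf)       (there sh) = x≤r ∷ shift-config cf sh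

  raise-dot : ∀ {y b c c'} → 1 ≤ y → Increasing (y ∷ b) → Raise r (y ∷ b) c c'
    → dot (y ∷ b) c < dot (y ∷ b) c'
  raise-dot {y} {b} {x ∷ c} 1≤y _ (add _) =
    ≤-trans (+-monoˡ-≤ (x * y + dot b c) 1≤y) (≤-reflexive (sym (+-assoc y (x * y) (dot b c))))
  raise-dot {y} {b} {c} {c'} _ inc (shift {lo = lo} {hi = hi} sh) =
    +-cancelʳ-< lo (dot (y ∷ b) c) (dot (y ∷ b) c')
      (subst (dot (y ∷ b) c + lo <_) (sym (shift-dot sh)) (+-monoʳ-< (dot (y ∷ b) c) (shift-lt inc sh)))

  raise-size : ∀ {b c c'} → Raise r b c c' → sum c ≤ sum c'
  raise-size (add _)    = n≤1+n _
  raise-size (shift sh) = ≤-reflexive (sym (shift-size sh))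

  raise-height : ∀ {b c c'} → Raise r b c c' → height c' ≡ suc (height c)
  raise-height {c = x ∷ c} (add _) = refl
  raise-height (shift sh)          = shift-height sh

  raise-config : ∀ {b c c'} → Config r b c → Raise r b c c' → Config r b c'
  raise-config (_ ∷ cf) (add x<r) = x<r ∷ cf
  raise-config cf (shift sh)      = shift-config cf sh

-- minHeight r n s is the height of the staircase (r,…,r,x,0,…,0) of length n and size s,
-- which is the least height of a configuration of size s.
minHeight : ℕ → ℕ → ℕ → ℕ
minHeight r zero    s = 0
minHeight r (suc n) s = s + minHeight r n (s ∸ r)

minHeight-zero : ∀ r n → minHeight r n 0 ≡ 0
minHeight-zero r zero    = refl
minHeight-zero r (suc n) = trans (cong (minHeight r n) (0∸n≡0 r)) (minHeight-zero r n)

module Extremes (r' : ℕ) where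

  R : ℕ
  R = suc r'

  data Staircase : List ℕ → Set where
    nil  : Staircase []
    full : ∀ {c} → Staircase c → Staircase (R ∷ c)
    part : ∀ {x c} → x ≤ R → All (_≡ 0) c → Staircase (x ∷ c)

  zeros-sum : ∀ {c} → All (_≡ 0) c → sum c ≡ 0
  zeros-sum []         = refl
  zeros-sum (refl ∷ z) = zeros-sum z

  zeros-height : ∀ {c} → All (_≡ 0) c → height c ≡ 0
  zeros-height []         = refl
  zeros-height {_ ∷ c} (refl ∷ z) = trans (cong (_+ height c) (zeros-sum z)) (zeros-height z)

  staircase-height : ∀ {c} → Staircase c → height c ≡ minHeight R (length c) (sum c)
  staircase-height nil = refl
  staircase-height {R ∷ c} (full st) rewrite m+n∸m≡n R (sum c) =
    cong ((R + sum c) +_) (staircase-height st)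
  staircase-height {x ∷ c} (part x≤R zs) rewrite zeros-sum zs | zeros-height zs | +-identityʳ x
    | m≤n⇒m∸n≡0 x≤R | minHeight-zero R (length c) = refl

  Shifted : List ℕ → List ℕ → Set
  Shifted b c = ∃ λ c'' → Config R b c'' × ∃₂ λ lo hi → Shift R b c'' c lo hi

  -- Every configuration is a staircase or the result of a shift: working backwards from the
  -- last coordinate, the first place where the staircase shape fails exhibits a unit that
  -- could be shifted back to the left.
  staircase-or-shifted : ∀ {b c} → Config R b c → Staircase c ⊎ Shifted b c
  staircase-or-shifted [] = inj₁ nil
  staircase-or-shifted (x≤R ∷ cf) with staircase-or-shifted cf
  ... | inj₂ (c'' , cf'' , lo , hi , sh) = inj₂ (_ , (x≤R ∷ cf'') , lo , hi , there sh)
  ... | inj₁ st = extend x≤R cf st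
    where
    extend : ∀ {x y b c} → x ≤ R → Config R b c → Staircase c → Staircase (x ∷ c) ⊎ Shifted (y ∷ b) (x ∷ c)
    extend x≤R [] nil = inj₁ (part x≤R [])
    extend {x} x≤R (_ ∷ cf) (full st) with x ≟ R
    ... | yes refl = inj₁ (full (full st))
    ... | no x≢R   = inj₂ (_ , (≤∧≢⇒< x≤R x≢R ∷ (n≤1+n r' ∷ cf)) , _ , _ , here ≤-refl)
    extend x≤R (_ ∷ cf) (part {zero} _ zs) = inj₁ (part x≤R (refl ∷ zs))
    extend {x} x≤R (_ ∷ cf) (part {suc z} z<R zs) with x ≟ R
    ... | yes refl = inj₁ (full (part z<R zs))
    ... | no x≢R   = inj₂ (_ , (≤∧≢⇒< x≤R x≢R ∷ (≤-trans (n≤1+n z) z<R ∷ cf)) , _ , _ , here z<R)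

  lower : ∀ {α b c} → Config R b c → α ≤ sum c →
    height c ≡ minHeight R (length b) α ⊎ ∃ λ c'' → Config R b c'' × α ≤ sum c'' × Raise R b c'' c
  lower {α} cf adm with staircase-or-shifted cf
  ... | inj₂ (c'' , cf'' , _ , _ , sh) = inj₂ (c'' , cf'' , subst (α ≤_) (shift-size sh) adm , shift sh)
  ... | inj₁ st with m≤n⇒m<n∨m≡n adm
  ...   | inj₂ α≡size = inj₁ (trans (staircase-height st) (cong₂ (minHeight R) (config-length cf) (sym α≡size)))
  ...   | inj₁ α<size = inj₂ (remove st cf α<size)
    where
    -- a staircase of size > α starts with a copy of b₁, which can be dropped
    remove : ∀ {b c} → Staircase c → Config R b c → α < sum c →
      ∃ λ c'' → Config R b c'' × α ≤ sum c'' × Raise R b c'' c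
    remove _ (_∷_ {suc x} x<R cf) (s≤s α≤size) = _ , (≤-trans (n≤1+n x) x<R ∷ cf) , α≤size , add x<R
    remove (part _ zs) (_∷_ {zero} _ _) α<size = contradiction (subst (α <_) (zeros-sum zs) α<size) λ ()

  raise-or-full : ∀ {b c} → Config R b c → c ≡ replicate (length b) R ⊎ ∃ λ c' → Raise R b c c'
  raise-or-full [] = inj₁ refl
  raise-or-full {c = x ∷ _} (x≤R ∷ cf) with x ≟ R
  ... | no x≢R = inj₂ (_ , add (≤∧≢⇒< x≤R x≢R))
  ... | yes refl with raise-or-full cf
  ...   | inj₁ eq                 = inj₁ (cong (R ∷_) eq)
  ...   | inj₂ (_ , shift sh)     = inj₂ (_ , shift (there sh))
  ...   | inj₂ (_ , add z<R)      = inj₂ (_ , shift (here z<R))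

  size-le-full : ∀ {b c} → Config R b c → sum c ≤ sum (replicate (length b) R)
  size-le-full []         = z≤n
  size-le-full (x≤R ∷ cf) = +-mono-≤ x≤R (size-le-full cf)

  height-le-full : ∀ {b c} → Config R b c → height c ≤ height (replicate (length b) R)
  height-le-full []         = z≤n
  height-le-full (x≤R ∷ cf) = +-mono-≤ (+-mono-≤ x≤R (size-le-full cf)) (height-le-full cf)

full-config : ∀ {r} bs → Config r bs (replicate (length bs) r)
full-config []       = []
full-config (_ ∷ bs) = ≤-refl ∷ full-config bs

++-config : ∀ {r ps pc bs cs} → Config r ps pc → Config r bs cs → Config r (ps ++ bs) (pc ++ cs)
++-config []        cf = cf
++-config (x ∷ pcf) cf = x ∷ ++-config pcf cf

shift-after : ∀ {r ps pc bs cs cs' lo hi} → Config r ps pc → Shift r bs cs cs' lo hi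
  → Shift r (ps ++ bs) (pc ++ cs) (pc ++ cs') lo hi
shift-after []        sh = sh
shift-after (_ ∷ pcf) sh = there (shift-after pcf sh)

sum-replicate : ∀ n x → sum (replicate n x) ≡ n * x
sum-replicate zero    x = refl
sum-replicate (suc n) x = cong (x +_) (sum-replicate n x)

linked-from : ∀ {P : ℕ → ℕ → Set} xs → (∀ ps y y' q → xs ≡ ps ++ y ∷ y' ∷ q → P y y') → Linked P xs
linked-from []          h = []
linked-from (x ∷ [])    h = [-]
linked-from (x ∷ y ∷ t) h = h [] x y t refl ∷ linked-from (y ∷ t) (λ ps u u' q eq → h (x ∷ ps) u u' q (cong (x ∷_) eq))

-- Chains of raises bound the number of members of U below and
-- above each admissible sum; when U has exactly hmax − hmin + 1 members (the extremal
-- case) these bounds leave no room for two raises of an admissible configuration to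
-- produce different sums.
module Extremal (r' : ℕ) (U : List ℕ) (y₁ : ℕ) (bs : List ℕ) (y₁-pos : 1 ≤ y₁)
  (inc : Increasing (y₁ ∷ bs)) (α : ℕ)
  (realised : ∀ {c} → Config (suc r') (y₁ ∷ bs) c → α ≤ sum c → dot (y₁ ∷ bs) c ∈ U)
  (extremal : length U + minHeight (suc r') (suc (length bs)) α
              ≡ height (replicate (suc (length bs)) (suc r')) + 1) where

  open Extremes r'

  b : List ℕ
  b = y₁ ∷ bs

  hmin hmax : ℕ
  hmin = minHeight R (length b) α
  hmax = height (replicate (length b) R)

  atMost below : ℕ → ℕ
  atMost s = count (_≤? s) U
  below t  = count (_<? t) U

  counted : ∀ {t} → t ∈ U → suc (below t) ≤ atMost t
  counted t∈U = count-strict (_<? _) (_≤? _) <⇒≤ U t∈U ≤-refl (<-irrefl refl)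

  atMost-step : ∀ {s t} → s < t → t ∈ U → suc (atMost s) ≤ atMost t
  atMost-step s<t t∈U = count-strict (_≤? _) (_≤? _) (λ p → ≤-trans p (<⇒≤ s<t)) U t∈U ≤-refl (<⇒≱ s<t)

  below-step : ∀ {s t} → s < t → s ∈ U → suc (below s) ≤ below t
  below-step s<t s∈U = count-strict (_<? _) (_<? _) (λ p → <-trans p s<t) U s∈U s<t (<-irrefl refl)

  below-length : ∀ {t} → t ∈ U → below t < length U
  below-length t∈U = filter-notAll (_<? _) U (Any.map (λ { refl → <-irrefl refl }) t∈U)

  gap : ∀ {s u t} → s < u → u < t → u ∈ U → suc (atMost s) ≤ below t
  gap s<u u<t u∈U = count-strict (_≤? _) (_<? _) (λ p → ≤-<-trans p (<-trans s<u u<t)) U u∈U u<t (<⇒≱ s<u)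

  -- Lowering c step by step to a minimal admissible configuration passes through
  -- height c − hmin + 1 distinct members of U that are at most dot b c.
  lowerBound : ∀ n {c} → Config R b c → α ≤ sum c → height c ≡ n → suc n ≤ atMost (dot b c) + hmin
  lowerBound n cf adm h with lower cf adm
  lowerBound n {c} cf adm h | inj₁ minimal = begin
    suc n                   ≡⟨ cong suc (trans (sym h) minimal) ⟩
    suc hmin                ≤⟨ +-monoˡ-≤ hmin (≤-trans (s≤s z≤n) (counted (realised cf adm))) ⟩
    atMost (dot b c) + hmin ∎
    where open ≤-Reasoning
  lowerBound zero cf adm h | inj₂ (_ , _ , _ , up) = contradiction (trans (sym (raise-height up)) h) λ ()
  lowerBound (suc n) {c} cf adm h | inj₂ (c'' , cf'' , adm'' , up) = begin
    suc (suc n)                     ≤⟨ s≤s (lowerBound n cf'' adm'' (suc-injective (trans (sym (raise-height up)) h))) ⟩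
    suc (atMost (dot b c'') + hmin) ≤⟨ +-monoˡ-≤ hmin (atMost-step (raise-dot y₁-pos inc up) (realised cf adm)) ⟩
    atMost (dot b c) + hmin         ∎
    where open ≤-Reasoning

  -- Raising c step by step to the full configuration passes through hmax − height c + 1
  -- distinct members of U that are at least dot b c.
  upperBound : ∀ n {c} → Config R b c → α ≤ sum c → height c + n ≡ hmax
    → suc (hmax + below (dot b c)) ≤ length U + height c
  upperBound n cf adm h with raise-or-full cf
  upperBound n {c} cf adm h | inj₁ refl = begin
    suc (hmax + below (dot b c)) ≡⟨ +-suc hmax _ ⟨
    hmax + suc (below (dot b c)) ≤⟨ +-monoʳ-≤ hmax (below-length (realised cf adm)) ⟩
    hmax + length U              ≡⟨ +-comm hmax (length U) ⟩
    length U + hmax              ∎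
    where open ≤-Reasoning
  upperBound zero {c} cf adm h | inj₂ (c' , up) = contradiction (height-le-full (raise-config cf up)) (<⇒≱ (begin-strict
    hmax          ≡⟨ trans (sym h) (+-identityʳ (height c)) ⟩
    height c      <⟨ n<1+n (height c) ⟩
    suc (height c) ≡⟨ raise-height up ⟨
    height c'     ∎))
    where open ≤-Reasoning
  upperBound (suc n) {c} cf adm h | inj₂ (c' , up) = s≤s⁻¹ (begin
    suc (suc (hmax + below (dot b c))) ≡⟨ cong suc (+-suc hmax _) ⟨
    suc (hmax + suc (below (dot b c))) ≤⟨ s≤s (+-monoʳ-≤ hmax (below-step (raise-dot y₁-pos inc up) (realised cf adm))) ⟩
    suc (hmax + below (dot b c'))      ≤⟨ upperBound n (raise-config cf up) (≤-trans adm (raise-size up)) h' ⟩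
    length U + height c'               ≡⟨ cong (length U +_) (raise-height up) ⟩
    length U + suc (height c)          ≡⟨ +-suc (length U) (height c) ⟩
    suc (length U + height c)          ∎)
    where
    open ≤-Reasoning
    h' : height c' + n ≡ hmax
    h' = trans (cong (_+ n) (raise-height up)) (trans (sym (+-suc (height c) n)) h)

  -- If two raises of an admissible c gave sums t₂ < t₁, the height c − hmin + 1 members
  -- ≤ dot b c (lowerBound), the member t₂, and the hmax − height c members ≥ t₁
  -- (upperBound) would be more than length U distinct members of U.
  no-gap : ∀ {c c₁ c₂} → Config R b c → α ≤ sum c → Raise R b c c₁ → Raise R b c c₂
    → ¬ (dot b c₂ < dot b c₁)
  no-gap {c} {c₁} {c₂} cf adm up₁ up₂ t₂<t₁ = <-irrefl refl (begin-strict
    hmax + 1 + X                 ≡⟨ +-assoc hmax 1 X ⟩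
    hmax + suc X                 ≤⟨ +-monoʳ-≤ hmax (gap (raise-dot y₁-pos inc up₂) t₂<t₁ (realised cf₂ adm₂)) ⟩
    hmax + below (dot b c₁)      <⟨ upperBound (hmax ∸ height c₁) cf₁ adm₁ (m+[n∸m]≡n (height-le-full cf₁)) ⟩
    length U + height c₁         ≡⟨ cong (length U +_) (raise-height up₁) ⟩
    length U + suc (height c)    ≤⟨ +-monoʳ-≤ (length U) (lowerBound (height c) cf adm refl) ⟩
    length U + (X + hmin)        ≡⟨ regroup (length U) X hmin ⟩
    length U + hmin + X          ≡⟨ cong (_+ X) extremal ⟩
    hmax + 1 + X                 ∎)
    where
    open ≤-Reasoning
    X : ℕ
    X = atMost (dot b c)
    cf₁ : Config R b c₁
    cf₁ = raise-config cf up₁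
    cf₂ : Config R b c₂
    cf₂ = raise-config cf up₂
    adm₁ : α ≤ sum c₁
    adm₁ = ≤-trans adm (raise-size up₁)
    adm₂ : α ≤ sum c₂
    adm₂ = ≤-trans adm (raise-size up₂)
    regroup : ∀ l x h → l + (x + h) ≡ l + h + x
    regroup = solve-∀

  raises-agree : ∀ {c c₁ c₂} → Config R b c → α ≤ sum c → Raise R b c c₁ → Raise R b c c₂
    → dot b c₁ ≡ dot b c₂
  raises-agree cf adm up₁ up₂ = ≤-antisym (≮⇒≥ (no-gap cf adm up₁ up₂)) (≮⇒≥ (no-gap cf adm up₂ up₁))

  add-agrees-with-shift : ∀ {x c₀ c' lo hi} → Config R b (x ∷ c₀) → α ≤ sum (x ∷ c₀) → x < R
    → Shift R b (x ∷ c₀) c' lo hi → hi ≡ lo + y₁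
  add-agrees-with-shift {x} {c₀} {c'} {lo} {hi} cf adm x<R sh = +-cancelˡ-≡ (dot b (x ∷ c₀)) hi (lo + y₁) (begin
    dot b (x ∷ c₀) + hi       ≡⟨ shift-dot sh ⟨
    dot b c' + lo             ≡⟨ cong (_+ lo) (raises-agree cf adm (add x<R) (shift sh)) ⟨
    dot b (suc x ∷ c₀) + lo   ≡⟨ regroup y₁ x (dot bs c₀) lo ⟩
    dot b (x ∷ c₀) + (lo + y₁) ∎)
    where
    open ≡-Reasoning
    regroup : ∀ y x d lo → y + x * y + d + lo ≡ x * y + d + (lo + y)
    regroup = solve-∀

  shifts-agree : ∀ {c c₁ c₂ lo₁ hi₁ lo₂ hi₂} → Config R b c → α ≤ sum c
    → Shift R b c c₁ lo₁ hi₁ → Shift R b c c₂ lo₂ hi₂ → hi₁ + lo₂ ≡ hi₂ + lo₁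
  shifts-agree {c} {c₁} {c₂} {lo₁} {hi₁} {lo₂} {hi₂} cf adm sh₁ sh₂ = +-cancelˡ-≡ (dot b c) _ _ (begin
    dot b c + (hi₁ + lo₂)   ≡⟨ +-assoc (dot b c) hi₁ lo₂ ⟨
    dot b c + hi₁ + lo₂     ≡⟨ cong (_+ lo₂) (shift-dot sh₁) ⟨
    dot b c₁ + lo₁ + lo₂    ≡⟨ cong (λ t → t + lo₁ + lo₂) (raises-agree cf adm (shift sh₁) (shift sh₂)) ⟩
    dot b c₂ + lo₁ + lo₂    ≡⟨ +-assoc (dot b c₂) lo₁ lo₂ ⟩
    dot b c₂ + (lo₁ + lo₂)  ≡⟨ cong (dot b c₂ +_) (+-comm lo₁ lo₂) ⟩
    dot b c₂ + (lo₂ + lo₁)  ≡⟨ +-assoc (dot b c₂) lo₂ lo₁ ⟨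
    dot b c₂ + lo₂ + lo₁    ≡⟨ cong (_+ lo₁) (shift-dot sh₂) ⟩
    dot b c + hi₂ + lo₁     ≡⟨ +-assoc (dot b c) hi₂ lo₁ ⟩
    dot b c + (hi₂ + lo₁)   ∎)
    where open ≡-Reasoning

  -- When every configuration missing only two copies is admissible, the extremal case
  -- forces consecutive terms to differ by y₁, i.e. b is y₁, 2y₁, 3y₁, … (for k ≥ 4).
  module Progression (room : α + 2 ≤ R * length b) where

    admissible : ∀ {c} → sum c + 2 ≡ R * length b → α ≤ sum c
    admissible size = +-cancelʳ-≤ 2 α _ (subst (α + 2 ≤_) (sym size) room)

    -- Missing a copy of y₁ and of y': adding y₁ agrees with shifting y to y'.
    tail-gap : ∀ ps y y' q → bs ≡ ps ++ y ∷ y' ∷ q → y' ≡ y + y₁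
    tail-gap ps y y' q refl =
      add-agrees-with-shift cf (admissible {c} size) ≤-refl (there (shift-after (full-config ps) (here ≤-refl)))
      where
      pc qc c : List ℕ
      pc = replicate (length ps) R
      qc = replicate (length q) R
      c  = r' ∷ (pc ++ R ∷ r' ∷ qc)
      cf : Config R b c
      cf = n≤1+n r' ∷ ++-config (full-config ps) (≤-refl ∷ (n≤1+n r' ∷ full-config q))
      size : sum c + 2 ≡ R * length b
      size = begin
        r' + sum (pc ++ R ∷ r' ∷ qc) + 2
          ≡⟨ cong (λ t → r' + t + 2) (sum-++ pc (R ∷ r' ∷ qc)) ⟩
        r' + (sum pc + (R + (r' + sum qc))) + 2
          ≡⟨ cong₂ (λ u v → r' + (u + (R + (r' + v))) + 2) (sum-replicate (length ps) R) (sum-replicate (length q) R) ⟩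
        r' + (length ps * R + (R + (r' + length q * R))) + 2
          ≡⟨ count-copies r' (length ps) (length q) ⟩
        R * suc (length ps + suc (suc (length q)))
          ≡⟨ cong (λ n → R * suc n) (length-++ ps) ⟨
        R * length b ∎
        where
        open ≡-Reasoning
        count-copies : ∀ r p q → r + (p * suc r + (suc r + (r + q * suc r))) + 2 ≡ suc r * suc (p + suc (suc q))
        count-copies = solve-∀

    -- Missing one copy each of y₁ and y₂ (possible when R ≥ 2): adding y₁ agrees with
    -- shifting y₁ to y₂.
    head-gap-wide : ∀ {r'' y₂ t} → r' ≡ suc r'' → bs ≡ y₂ ∷ t → y₂ ≡ y₁ + y₁
    head-gap-wide {r''} {y₂} {t} refl refl = add-agrees-with-shift cf (admissible {c} size) ≤-refl (here ≤-refl)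
      where
      qc c : List ℕ
      qc = replicate (length t) R
      c  = r' ∷ r' ∷ qc
      cf : Config R b c
      cf = n≤1+n r' ∷ (n≤1+n r' ∷ full-config t)
      size : sum c + 2 ≡ R * length b
      size = trans (cong (λ v → r' + (r' + v) + 2) (sum-replicate (length t) R)) (count-copies r' (length t))
        where
        count-copies : ∀ r q → r + (r + q * suc r) + 2 ≡ suc r * suc (suc q)
        count-copies = solve-∀

    -- For R = 1 take the selection 1,0,1,0,1,…,1: shifting y₁ to y₂ agrees with
    -- shifting y₃ to y₄, and y₄ − y₃ = y₁ by tail-gap.
    head-gap-unit : ∀ {y₂ y₃ y₄ q} → r' ≡ 0 → bs ≡ y₂ ∷ y₃ ∷ y₄ ∷ q → y₂ ≡ y₁ + y₁
    head-gap-unit {y₂} {y₃} {y₄} {q} refl refl = +-cancelʳ-≡ y₃ y₂ (y₁ + y₁) (begin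
      y₂ + y₃        ≡⟨ shifts-agree cf (admissible {c} size) (here (s≤s z≤n)) (there (there (here (s≤s z≤n)))) ⟩
      y₄ + y₁        ≡⟨ cong (_+ y₁) (tail-gap (y₂ ∷ []) y₃ y₄ q refl) ⟩
      y₃ + y₁ + y₁   ≡⟨ +-comm (y₃ + y₁) y₁ ⟩
      y₁ + (y₃ + y₁) ≡⟨ cong (y₁ +_) (+-comm y₃ y₁) ⟩
      y₁ + (y₁ + y₃) ≡⟨ +-assoc y₁ y₁ y₃ ⟨
      y₁ + y₁ + y₃   ∎)
      where
      open ≡-Reasoning
      qc c : List ℕ
      qc = replicate (length q) 1
      c  = 1 ∷ 0 ∷ 1 ∷ 0 ∷ qc
      cf : Config 1 b c
      cf = ≤-refl ∷ (z≤n ∷ (≤-refl ∷ (z≤n ∷ full-config q)))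
      size : sum c + 2 ≡ 1 * length b
      size = trans (cong (λ v → 2 + v + 2) (sum-replicate (length q) 1)) (count-copies (length q))
        where
        count-copies : ∀ q → 2 + q * 1 + 2 ≡ 1 * suc (suc (suc (suc q)))
        count-copies = solve-∀

    head-gap : ∀ {y₂} t → 4 ≤ length b → bs ≡ y₂ ∷ t → y₂ ≡ y₁ + y₁
    head-gap t k≥4 eq = by-capacity r' refl t k≥4 eq
      where
      by-capacity : ∀ n → r' ≡ n → ∀ {y₂} t → 4 ≤ length b → bs ≡ y₂ ∷ t → y₂ ≡ y₁ + y₁
      by-capacity (suc _) r'≡ t           _   eq = head-gap-wide r'≡ eq
      by-capacity zero    r'≡ (_ ∷ _ ∷ _) _   eq = head-gap-unit r'≡ eq
      by-capacity zero    _   []          (s≤s (s≤s ())) refl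
      by-capacity zero    _   (_ ∷ [])    (s≤s (s≤s (s≤s ()))) refl

    gaps : 4 ≤ length b → Linked (λ x y → y ≡ x + y₁) b
    gaps k≥4 = linked-from b gap-at
      where
      gap-at : ∀ ps y y' q → b ≡ ps ++ y ∷ y' ∷ q → y' ≡ y + y₁
      gap-at []       y y' q refl = head-gap q k≥4 refl
      gap-at (_ ∷ ps) y y' q refl = tail-gap ps y y' q refl

sum-in-Σ : ∀ α xs {ys} → ys ∈ subseqs xs → α ≤ length ys → sum ys ∈ Σ-list α xs
sum-in-Σ α xs ys∈ α≤ = ∈-deduplicate⁺ _≟_ (∈-map⁺ sum (∈-filter⁺ (λ ys → α ≤? length ys) ys∈ α≤))

keep : ∀ x xs {ys} → ys ∈ subseqs xs → x ∷ ys ∈ subseqs (x ∷ xs)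
keep x xs ys∈ = ∈-++⁺ˡ (∈-map⁺ (x ∷_) ys∈)

skip : ∀ x xs {ys} → ys ∈ subseqs xs → ys ∈ subseqs (x ∷ xs)
skip x xs ys∈ = ∈-++⁺ʳ (map (x ∷_) (subseqs xs)) ys∈

keep-or-skip : ∀ {x xs ys} → ys ∈ subseqs (x ∷ xs)
  → (∃ λ zs → zs ∈ subseqs xs × ys ≡ x ∷ zs) ⊎ ys ∈ subseqs xs
keep-or-skip {x} {xs} ys∈ with ∈-++⁻ (map (x ∷_) (subseqs xs)) ys∈
... | inj₁ kept    = inj₁ (∈-map⁻ (x ∷_) kept)
... | inj₂ skipped = inj₂ skipped

subseq-++ : ∀ xs {ys us vs} → us ∈ subseqs xs → vs ∈ subseqs ys → us ++ vs ∈ subseqs (xs ++ ys)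
subseq-++ []       (here refl) vs∈ = vs∈
subseq-++ (x ∷ xs) us∈ vs∈ with keep-or-skip {x} {xs} us∈
... | inj₁ (us' , us'∈ , refl) = keep x (xs ++ _) (subseq-++ xs us'∈ vs∈)
... | inj₂ us∈'               = skip x (xs ++ _) (subseq-++ xs us∈' vs∈)

subseq-replicate : ∀ r {x y} → x ≤ r → replicate x y ∈ subseqs (replicate r y)
subseq-replicate zero    z≤n        = here refl
subseq-replicate (suc r) {zero}  {y} _       = skip y (replicate r y) (subseq-replicate r z≤n)
subseq-replicate (suc r) {suc x} {y} (s≤s p) = keep y (replicate r y) (subseq-replicate r p)

SubseqLike : List ℕ → List ℕ → Set
SubseqLike xs ys = ∃ λ ys' → ys' ∈ subseqs xs × length ys' ≡ length ys × sum ys' ≡ sum ys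

config-subseq : ∀ {r b c} → Config r b c
  → ∃ λ ys → ys ∈ subseqs (rep r b) × length ys ≡ sum c × sum ys ≡ dot b c
config-subseq [] = [] , here refl , refl , refl
config-subseq {r} {y ∷ b} {x ∷ c} (x≤r ∷ cf) with config-subseq cf
... | ys , ys∈ , len , total =
  replicate x y ++ ys , subseq-++ (replicate r y) (subseq-replicate r x≤r) ys∈ ,
  trans (length-++ (replicate x y)) (cong₂ _+_ (length-replicate x) len) ,
  trans (sum-++ (replicate x y) ys) (cong₂ _+_ (sum-replicate x y) total)

subseq-↭ : ∀ {xs xs' ys} → xs ↭ xs' → ys ∈ subseqs xs → SubseqLike xs' ys
subseq-↭ ↭-refl ys∈ = _ , ys∈ , refl , refl
subseq-↭ (↭-trans p q) ys∈ with subseq-↭ p ys∈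
... | ys₁ , ys₁∈ , len₁ , sum₁ with subseq-↭ q ys₁∈
...   | ys₂ , ys₂∈ , len₂ , sum₂ = ys₂ , ys₂∈ , trans len₂ len₁ , trans sum₂ sum₁
subseq-↭ {x ∷ xs} {x ∷ xs'} (prep x p) ys∈ with keep-or-skip {x} {xs} ys∈
... | inj₁ (zs , zs∈ , refl) with subseq-↭ p zs∈
...   | zs' , zs'∈ , len , total = x ∷ zs' , keep x xs' zs'∈ , cong suc len , cong (x +_) total
subseq-↭ {x ∷ xs} {x ∷ xs'} (prep x p) ys∈ | inj₂ zs∈ with subseq-↭ p zs∈
...   | zs' , zs'∈ , len , total = zs' , skip x xs' zs'∈ , len , total
subseq-↭ {x ∷ y ∷ xs} {y ∷ x ∷ xs'} (swap x y p) ys∈ with keep-or-skip {x} {y ∷ xs} ys∈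
... | inj₁ (ws , ws∈ , refl) with keep-or-skip {y} {xs} ws∈
...   | inj₁ (zs , zs∈ , refl) with subseq-↭ p zs∈
...     | zs' , zs'∈ , len , total =
  y ∷ x ∷ zs' , keep y (x ∷ xs') (keep x xs' zs'∈) , cong (λ n → suc (suc n)) len ,
  trans (cong (λ s → y + (x + s)) total) (x+y+s-comm y x (sum zs))
  where
  x+y+s-comm : ∀ y x s → y + (x + s) ≡ x + (y + s)
  x+y+s-comm = solve-∀
subseq-↭ {x ∷ y ∷ xs} {y ∷ x ∷ xs'} (swap x y p) ys∈ | inj₁ (ws , ws∈ , refl) | inj₂ zs∈ with subseq-↭ p zs∈
...     | zs' , zs'∈ , len , total = x ∷ zs' , skip y (x ∷ xs') (keep x xs' zs'∈) , cong suc len , cong (x +_) total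
subseq-↭ {x ∷ y ∷ xs} {y ∷ x ∷ xs'} (swap x y p) ys∈ | inj₂ ws∈ with keep-or-skip {y} {xs} ws∈
...   | inj₁ (zs , zs∈ , refl) with subseq-↭ p zs∈
...     | zs' , zs'∈ , len , total = y ∷ zs' , keep y (x ∷ xs') (skip x xs' zs'∈) , cong suc len , cong (y +_) total
subseq-↭ {x ∷ y ∷ xs} {y ∷ x ∷ xs'} (swap x y p) ys∈ | inj₂ ws∈ | inj₂ zs∈ with subseq-↭ p zs∈
...     | zs' , zs'∈ , len , total = zs' , skip y (x ∷ xs') (skip x xs' zs'∈) , len , total

rep-↭ : ∀ r {xs ys} → xs ↭ ys → rep r xs ↭ rep r ys
rep-↭ r ↭-refl        = ↭-refl
rep-↭ r (prep x p)    = ++⁺ˡ (replicate r x) (rep-↭ r p)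
rep-↭ r (swap x y p)  = ↭-trans (shifts (replicate r x) (replicate r y))
                                (++⁺ˡ (replicate r y) (++⁺ˡ (replicate r x) (rep-↭ r p)))
rep-↭ r (↭-trans p q) = ↭-trans (rep-↭ r p) (rep-↭ r q)

realised-in-Σ : ∀ {r k} {a : Fin k → ℕ} {b c α} → b ↭ tabulate a → Config r b c → α ≤ sum c
  → dot b c ∈ Σ-list α (seqOf r a)
realised-in-Σ {r} {a = a} {b} {c} {α} b↭ cf adm with config-subseq cf
... | ys , ys∈ , len , total with subseq-↭ (rep-↭ r b↭) ys∈
...   | ys' , ys'∈ , len' , total' =
  subst (_∈ Σ-list α (seqOf r a)) (trans total' total)
    (sum-in-Σ α (seqOf r a) ys'∈ (subst (α ≤_) (sym (trans len' len)) adm))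

tri : ℕ → ℕ
tri zero    = 0
tri (suc n) = suc n + tri n

tri-double : ∀ n → tri n * 2 ≡ n * (n + 1)
tri-double zero    = refl
tri-double (suc n) = trans (*-distribʳ-+ 2 (suc n) (tri n)) (trans (cong (suc n * 2 +_) (tri-double n)) (step n))
  where
  step : ∀ n → suc n * 2 + n * (n + 1) ≡ suc n * (suc n + 1)
  step = solve-∀

tri-half : ∀ n → n * (n + 1) / 2 ≡ tri n
tri-half n = trans (cong (_/ 2) (sym (tri-double n))) (m*n/n≡m (tri n) 2)

tri-half-suc : ∀ n → n * suc n / 2 ≡ tri n
tri-half-suc n = trans (cong (λ t → n * t / 2) (+-comm 1 n)) (tri-half n)

tri-mono : ∀ {m n} → m ≤ n → tri m ≤ tri n
tri-mono {zero}              _       = z≤n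
tri-mono {suc m} {suc n} (s≤s m≤n) = +-mono-≤ (s≤s m≤n) (tri-mono m≤n)

height-full : ∀ r n → height (replicate n r) ≡ r * tri n
height-full r zero    = sym (*-zeroʳ r)
height-full r (suc n) =
  trans (cong₂ (λ u v → r + u + v) (sum-replicate n r) (height-full r n)) (regroup r n (tri n))
  where
  regroup : ∀ r n t → r + n * r + r * t ≡ r * (suc n + t)
  regroup = solve-∀

minHeight-closed : ∀ r n m e → e < r → m < n → minHeight r n (m * r + e) + r * tri m ≡ suc m * (m * r + e)
minHeight-closed r (suc n) zero e e<r _ =
  trans (cong₂ (λ u v → e + minHeight r n u + v) (m≤n⇒m∸n≡0 (<⇒≤ e<r)) (*-zeroʳ r))
    (trans (cong (λ t → e + t + 0) (minHeight-zero r n)) (simplify e))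
  where
  simplify : ∀ e → e + 0 + 0 ≡ 1 * e
  simplify = solve-∀
minHeight-closed r (suc n) (suc m) e e<r (s≤s m<n) = begin
  suc m * r + e + minHeight r n (suc m * r + e ∸ r) + r * (suc m + tri m)
    ≡⟨ regroup (suc m * r + e) (minHeight r n (suc m * r + e ∸ r)) (tri m) m r ⟩
  suc m * r + e + (minHeight r n (suc m * r + e ∸ r) + r * tri m) + r * suc m
    ≡⟨ cong (λ s → suc m * r + e + (minHeight r n s + r * tri m) + r * suc m) drop-r ⟩
  suc m * r + e + (minHeight r n (m * r + e) + r * tri m) + r * suc m
    ≡⟨ cong (λ t → suc m * r + e + t + r * suc m) (minHeight-closed r n m e e<r m<n) ⟩
  suc m * r + e + suc m * (m * r + e) + r * suc m
    ≡⟨ collect r m e ⟩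
  suc (suc m) * (suc m * r + e) ∎
  where
  open ≡-Reasoning
  drop-r : suc m * r + e ∸ r ≡ m * r + e
  drop-r = trans (cong (_∸ r) (+-assoc r (m * r) e)) (m+n∸m≡n r (m * r + e))
  regroup : ∀ α X T m r → α + X + r * (suc m + T) ≡ α + (X + r * T) + r * suc m
  regroup = solve-∀
  collect : ∀ r m e → suc m * r + e + suc m * (m * r + e) + r * suc m ≡ suc (suc m) * (suc m * r + e)
  collect = solve-∀

-- The common algebra of both cardinalities, writing r = e + f with α = m·r + e.
count-identity : ∀ r e f m D M → r ≡ e + f → M + r * tri m ≡ suc m * (m * r + e)
  → r * D + suc m * f + 1 + M ≡ r * (tri (suc m) + D) + 1
count-identity _ e f m D M refl h = +-cancelʳ-≡ ((e + f) * tri m) _ _ (begin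
  (e + f) * D + suc m * f + 1 + M + (e + f) * tri m
    ≡⟨ +-assoc ((e + f) * D + suc m * f + 1) M _ ⟩
  (e + f) * D + suc m * f + 1 + (M + (e + f) * tri m)
    ≡⟨ cong ((e + f) * D + suc m * f + 1 +_) h ⟩
  (e + f) * D + suc m * f + 1 + suc m * (m * (e + f) + e)
    ≡⟨ expand e f m D ⟩
  (e + f) * (suc m + D) + 1 + (e + f) * (m * (m + 1))
    ≡⟨ cong (λ t → (e + f) * (suc m + D) + 1 + (e + f) * t) (sym (tri-double m)) ⟩
  (e + f) * (suc m + D) + 1 + (e + f) * (tri m * 2)
    ≡⟨ collect (e + f) m D (tri m) ⟩
  (e + f) * (suc m + tri m + D) + 1 + (e + f) * tri m ∎)
  where
  open ≡-Reasoning
  expand : ∀ e f m D → (e + f) * D + suc m * f + 1 + suc m * (m * (e + f) + e)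
                     ≡ (e + f) * (suc m + D) + 1 + (e + f) * (m * (m + 1))
  expand = solve-∀
  collect : ∀ r m D T → r * (suc m + D) + 1 + r * (T * 2) ≡ r * (suc m + T + D) + 1 + r * T
  collect = solve-∀

module Decompose (r m α : ℕ) (lo : m * r ≤ α) (hi : α < suc m * r) where
  e f : ℕ
  e = α ∸ m * r
  f = r ∸ e

  α≡ : α ≡ m * r + e
  α≡ = sym (m+[n∸m]≡n lo)

  e<r : e < r
  e<r = +-cancelˡ-< (m * r) e r (subst (_< m * r + r) α≡ (subst (α <_) (+-comm r (m * r)) hi))

  r≡e+f : r ≡ e + f
  r≡e+f = sym (m+[n∸m]≡n (<⇒≤ e<r))

  deficit : suc m * r ∸ α ≡ f
  deficit = trans (cong₂ _∸_ (trans (+-comm r (m * r)) (cong (m * r +_) r≡e+f)) α≡)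
              (trans (cong (_∸ (m * r + e)) (sym (+-assoc (m * r) e f))) (m+n∸m≡n (m * r + e) f))

positive-count : ∀ r k m α L → m * r ≤ α → α < suc m * r → suc m ≤ k
  → L ≡ r * (k * (k + 1) / 2 ∸ suc m * (suc m + 1) / 2) + suc m * (suc m * r ∸ α) + 1
  → L + minHeight r k α ≡ height (replicate k r) + 1
positive-count r k m α L lo hi m<k hL = begin
  L + minHeight r k α
    ≡⟨ cong (_+ minHeight r k α) (trans hL (cong₂ (λ u v → r * u + suc m * v + 1)
         (cong₂ _∸_ (tri-half k) (tri-half (suc m))) deficit)) ⟩
  r * (tri k ∸ tri (suc m)) + suc m * f + 1 + minHeight r k α
    ≡⟨ count-identity r e f m (tri k ∸ tri (suc m)) _ r≡e+f
         (trans (cong (λ t → minHeight r k t + r * tri m) α≡) (minHeight-closed r k m e e<r m<k)) ⟩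
  r * (tri (suc m) + (tri k ∸ tri (suc m))) + 1
    ≡⟨ cong (λ t → r * t + 1) (m+[n∸m]≡n (tri-mono m<k)) ⟩
  r * tri k + 1
    ≡⟨ cong (_+ 1) (height-full r k) ⟨
  height (replicate k r) + 1 ∎
  where
  open ≡-Reasoning
  open Decompose r m α lo hi

-- The second cardinality is hmax − hmin + 1 for the k − 1 = n nonzero terms and α − r.
zero-count : ∀ r n m α L → m * r ≤ α → α < suc m * r → suc m ≤ suc n
  → L ≡ r * ((suc n ∸ 1) * suc n / 2 ∸ (suc m ∸ 1) * suc m / 2) + (suc m ∸ 1) * (suc m * r ∸ α) + 1
  → L + minHeight r n (α ∸ r) ≡ height (replicate n r) + 1
zero-count r n zero α L lo hi _ hL = begin
  L + minHeight r n (α ∸ r)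
    ≡⟨ cong₂ _+_ (trans hL (cong (λ t → r * (t ∸ 0) + 0 + 1) (tri-half-suc n)))
         (trans (cong (minHeight r n) (m≤n⇒m∸n≡0 (<⇒≤ (subst (α <_) (+-identityʳ r) hi)))) (minHeight-zero r n)) ⟩
  r * tri n + 0 + 1 + 0
    ≡⟨ simplify (r * tri n) ⟩
  r * tri n + 1
    ≡⟨ cong (_+ 1) (height-full r n) ⟨
  height (replicate n r) + 1 ∎
  where
  open ≡-Reasoning
  simplify : ∀ x → x + 0 + 1 + 0 ≡ x + 1
  simplify = solve-∀
zero-count r n (suc m) α L lo hi (s≤s m<n) hL = begin
  L + minHeight r n (α ∸ r)
    ≡⟨ cong₂ _+_ (trans hL (cong₂ (λ u v → r * u + suc m * v + 1)
         (cong₂ _∸_ (tri-half-suc n) (tri-half-suc (suc m))) deficit)) (cong (minHeight r n) α-r≡) ⟩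
  r * (tri n ∸ tri (suc m)) + suc m * f + 1 + minHeight r n (m * r + e)
    ≡⟨ count-identity r e f m (tri n ∸ tri (suc m)) _ r≡e+f (minHeight-closed r n m e e<r m<n) ⟩
  r * (tri (suc m) + (tri n ∸ tri (suc m))) + 1
    ≡⟨ cong (λ t → r * t + 1) (m+[n∸m]≡n (tri-mono m<n)) ⟩
  r * tri n + 1
    ≡⟨ cong (_+ 1) (height-full r n) ⟨
  height (replicate n r) + 1 ∎
  where
  open ≡-Reasoning
  open Decompose r (suc m) α lo hi
  α-r≡ : α ∸ r ≡ m * r + e
  α-r≡ = trans (cong (_∸ r) (trans α≡ (+-assoc r (m * r) e))) (m+n∸m≡n r (m * r + e))

strictly-sorted : ∀ {xs} → Linked _≤_ xs → Unique xs → Increasing xs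
strictly-sorted []       _                   = []
strictly-sorted [-]      _                   = [-]
strictly-sorted (x≤y ∷ s) ((x≢y ∷ _) ∷ u) = ≤∧≢⇒< x≤y x≢y ∷ strictly-sorted s u

sorted-terms : ∀ {k} (a : Fin k → ℕ) → (∀ i j → a i ≡ a j → i ≡ j)
  → ∃ λ b → b ↭ tabulate a × Increasing b × length b ≡ k
sorted-terms a inj =
  sort (tabulate a) , sort-↭ (tabulate a) ,
  strictly-sorted (sort-↗ (tabulate a))
    (Unique-resp-↭ (↭⇒↭ₛ (↭-sym (sort-↭ (tabulate a)))) (Uniqueₚ.tabulate⁺ (λ {i} {j} → inj i j))) ,
  trans (↭-length (sort-↭ (tabulate a))) (length-tabulate a)

applyUpTo-cong : ∀ {f g : ℕ → ℕ} n → (∀ i → f i ≡ g i) → applyUpTo f n ≡ applyUpTo g n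
applyUpTo-cong zero    f≗g = refl
applyUpTo-cong (suc n) f≗g = cong₂ _∷_ (f≗g 0) (applyUpTo-cong n (λ i → f≗g (suc i)))

Gaps : ℕ → List ℕ → Set
Gaps d = Linked (λ u v → v ≡ u + d)

progression : ∀ {d} x t → Gaps d (x ∷ t) → x ∷ t ≡ applyUpTo (λ i → x + i * d) (suc (length t))
progression x []      _               = cong (_∷ []) (sym (+-identityʳ x))
progression {d} x (y ∷ t) (refl ∷ gaps) = cong₂ _∷_ (sym (+-identityʳ x))
  (trans (progression y t gaps) (applyUpTo-cong (suc (length t)) (λ i → regroup x d i)))
  where
  regroup : ∀ x d i → x + d + i * d ≡ x + suc i * d
  regroup = solve-∀

scale-rep : ∀ d r xs → d *seq rep r xs ≡ rep r (map (d *_) xs)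
scale-rep d r xs = begin
  map (d *_) (concatMap (replicate r) xs)       ≡⟨ map-concatMap (d *_) (replicate r) xs ⟩
  concatMap (map (d *_) ∘ replicate r) xs       ≡⟨ concatMap-cong (map-replicate (d *_) r) xs ⟩
  concatMap (replicate r ∘ (d *_)) xs           ≡⟨ concatMap-map (replicate r) (d *_) xs ⟨
  concatMap (replicate r) (map (d *_) xs)       ∎
  where open ≡-Reasoning

multiples-oneTo : ∀ r d t → Gaps d (d ∷ t) → rep r (d ∷ t) ≡ d *seq oneTo (suc (length t)) r
multiples-oneTo r d t gaps = trans (cong (rep r) terms) (sym (scale-rep d r (map suc (upTo n))))
  where
  open ≡-Reasoning
  n : ℕ
  n = suc (length t)
  terms : d ∷ t ≡ map (d *_) (map suc (upTo n))
  terms = begin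
    d ∷ t                           ≡⟨ progression d t gaps ⟩
    applyUpTo (λ i → suc i * d) n   ≡⟨ applyUpTo-cong n (λ i → *-comm (suc i) d) ⟩
    applyUpTo (λ i → d * suc i) n   ≡⟨ map-applyUpTo suc (d *_) n ⟨
    map (d *_) (applyUpTo suc n)    ≡⟨ cong (map (d *_)) (map-upTo suc n) ⟨
    map (d *_) (map suc (upTo n))   ∎

multiples-zeroTo : ∀ r d t → Gaps d (0 ∷ t) → rep r (0 ∷ t) ≡ d *seq zeroTo (suc (length t)) r
multiples-zeroTo r d t gaps = trans (cong (rep r) terms) (sym (scale-rep d r (upTo n)))
  where
  open ≡-Reasoning
  n : ℕ
  n = suc (length t)
  terms : 0 ∷ t ≡ map (d *_) (upTo n)
  terms = begin
    0 ∷ t                       ≡⟨ progression 0 t gaps ⟩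
    applyUpTo (λ i → i * d) n   ≡⟨ applyUpTo-cong n (λ i → *-comm i d) ⟩
    applyUpTo (d *_) n          ≡⟨ map-upTo (d *_) n ⟨
    map (d *_) (upTo n)         ∎

zero-first : ∀ {x y t} → Increasing (x ∷ y ∷ t) → 0 ∈ x ∷ y ∷ t → x ≡ 0
zero-first _              (here 0≡x) = sym 0≡x
zero-first (x<y ∷ inc) (there 0∈t) = contradiction (All.lookup (Linked⇒All <-trans x<y inc) 0∈t) n≮0

positive-terms : ∀ {k} r' α (a : Fin k → ℕ) → (∀ i j → a i ≡ a j → i ≡ j) → (∀ i → 1 ≤ a i)
  → 4 ≤ k → α + 2 ≤ suc r' * k
  → card-Σ α (seqOf (suc r') a) + minHeight (suc r') k α ≡ height (replicate k (suc r')) + 1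
  → ∃ λ d → 1 ≤ d × seqOf (suc r') a ↭ d *seq oneTo k (suc r')
positive-terms r' α a inj pos k≥4 room extremal with sorted-terms a inj
positive-terms r' α a inj pos () room extremal | [] , _ , _ , refl
... | y₁ ∷ bs , b↭ , inc , refl =
  y₁ , y₁-pos ,
  ↭-trans (rep-↭ (suc r') (↭-sym b↭)) (↭-reflexive (multiples-oneTo (suc r') y₁ bs (gaps k≥4)))
  where
  y₁-pos : 1 ≤ y₁
  y₁-pos = All.head (All-resp-↭ (↭-sym b↭) (Allₚ.tabulate⁺ {P = 1 ≤_} {f = a} pos))
  open Extremal r' (Σ-list α (seqOf (suc r') a)) y₁ bs y₁-pos inc α (realised-in-Σ {a = a} b↭) extremal
  open Progression room

-- The case with a zero term: the sorted terms are 0 < y₁ < …, selecting all copies of 0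
-- costs nothing, so the positive terms y₁, … are extremal for α − r; they are
-- d, 2d, …, (k−1)d with d = y₁.
zero-terms : ∀ {k} r' α (a : Fin k → ℕ) → (∀ i j → a i ≡ a j → i ≡ j) → (∃ λ i → a i ≡ 0)
  → 5 ≤ k → α ∸ suc r' + 2 ≤ suc r' * (k ∸ 1)
  → card-Σ α (seqOf (suc r') a) + minHeight (suc r') (k ∸ 1) (α ∸ suc r')
    ≡ height (replicate (k ∸ 1) (suc r')) + 1
  → ∃ λ d → 1 ≤ d × seqOf (suc r') a ↭ d *seq zeroTo k (suc r')
zero-terms r' α a inj (i , ai≡0) k≥5 room extremal with sorted-terms a inj
zero-terms r' α a inj (i , ai≡0) () room extremal | [] , _ , _ , refl
zero-terms r' α a inj (i , ai≡0) (s≤s ()) room extremal | _ ∷ [] , _ , _ , refl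
... | x ∷ y₁ ∷ bs , b↭ , inc@(x<y₁ ∷ inc') , refl
  with zero-first inc (Any-resp-↭ (↭-sym b↭) (subst (_∈ tabulate a) ai≡0 (∈-tabulate⁺ {f = a} i)))
...   | refl =
  y₁ , x<y₁ ,
  ↭-trans (rep-↭ R (↭-sym b↭)) (↭-reflexive (multiples-zeroTo R y₁ (y₁ ∷ bs) (refl ∷ gaps (s≤s⁻¹ k≥5))))
  where
  R : ℕ
  R = suc r'
  with-all-zeros : ∀ {c} → Config R (y₁ ∷ bs) c → α ∸ R ≤ sum c → dot (y₁ ∷ bs) c ∈ Σ-list α (seqOf R a)
  with-all-zeros {c} cf adm = subst (_∈ Σ-list α (seqOf R a)) (cong (_+ dot (y₁ ∷ bs) c) (*-zeroʳ R))
    (realised-in-Σ {a = a} {c = R ∷ c} b↭ (≤-refl ∷ cf) (≤-trans (m≤n+m∸n α R) (+-monoʳ-≤ R adm)))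
  open Extremal r' (Σ-list α (seqOf R a)) y₁ bs x<y₁ inc' (α ∸ R) with-all-zeros extremal
  open Progression room

room-of : ∀ {α N} → 2 ≤ N → α ≤ N ∸ 2 → α + 2 ≤ N
room-of {α} {N} 2≤N α≤ = subst (α + 2 ≤_) (m∸n+n≡m 2≤N) (+-monoˡ-≤ 2 α≤)

room-without-zeros : ∀ R N α → 2 ≤ N → α + 2 ≤ R + N → α ∸ R + 2 ≤ N
room-without-zeros R N α 2≤N room with R ≤? α
... | yes R≤α = +-cancelˡ-≤ R _ _ (subst (_≤ R + N) split room)
  where
  split : α + 2 ≡ R + (α ∸ R + 2)
  split = trans (cong (_+ 2) (sym (m+[n∸m]≡n R≤α))) (+-assoc R (α ∸ R) 2)
... | no  R≰α = subst (λ s → s + 2 ≤ N) (sym (m≤n⇒m∸n≡0 (<⇒≤ (≰⇒> R≰α)))) 2≤N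

corollary3p7 : (k r α m : ℕ) → 5 ≤ k → 1 ≤ r → α ≤ r * k ∸ 2
  → 1 ≤ m → m ≤ k → (m ∸ 1) * r ≤ α → α < m * r
  → ((a : Fin k → ℕ) → (∀ i j → a i ≡ a j → i ≡ j) → (∀ i → 1 ≤ a i)
      → card-Σ α (seqOf r a) ≡ r * (k * (k + 1) / 2 ∸ m * (m + 1) / 2) + m * (m * r ∸ α) + 1
      → ∃ λ d → 1 ≤ d × seqOf r a ↭ d *seq oneTo k r)
  × ((a : Fin k → ℕ) → (∀ i j → a i ≡ a j → i ≡ j) → (∃ λ i → a i ≡ 0)
      → card-Σ α (seqOf r a) ≡ r * ((k ∸ 1) * k / 2 ∸ (m ∸ 1) * m / 2) + (m ∸ 1) * (m * r ∸ α) + 1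
      → ∃ λ d → 1 ≤ d × seqOf r a ↭ d *seq zeroTo k r)
corollary3p7 zero    _        _ _       ()  _ _ _ _ _ _
corollary3p7 (suc n) zero     _ _       _   () _ _ _ _ _
corollary3p7 (suc n) (suc r') _ zero    _   _ _ () _ _ _
corollary3p7 (suc n) (suc r') α (suc m) k≥5 _ α≤ _ m≤k lo hi =
  (λ a inj pos card → positive-terms r' α a inj pos (≤-trans (n≤1+n 4) k≥5) room
                        (positive-count R (suc n) m α _ lo hi m≤k card)) ,
  (λ a inj has-zero card → zero-terms r' α a inj has-zero k≥5
                             (room-without-zeros R (R * n) α 2≤Rn (subst (α + 2 ≤_) (*-suc R n) room))
                             (zero-count R n m α _ lo hi m≤k card))
  where
  R : ℕ
  R = suc r'
  2≤Rn : 2 ≤ R * n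
  2≤Rn = ≤-trans (s≤s (s≤s z≤n)) (≤-trans (s≤s⁻¹ k≥5) (m≤m+n n (r' * n)))
  room : α + 2 ≤ R * suc n
  room = room-of (≤-trans 2≤Rn (≤-trans (m≤n+m (R * n) R) (≤-reflexive (sym (*-suc R n))))) α≤
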